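{- If a connected graph $G\in Free(\{K_{1,3},hammer\})$ contains the chordless cycle $C_n$ with $n\geq 7$ as an induced subgraph, then $G$ is isomorphic to $C_n$.
   Context: All graphs are finite and simple. $Free(\mathcal S)$ is the class of graphs containing no member of $\mathcal S$ as an induced subgraph. $K_{1,3}$ is the claw; $C_n$ is the chordless cycle on $n$ vertices. The graph $hammer$ has vertex set $\{x_1,\dots,x_5\}$ and edge set $\{x_1x_2,x_1x_3,x_2x_3,x_1x_4,x_4x_5\}$. -}

module Defs where

open import Data.Nat using (ℕ; zero; suc; _≡ᵇ_)
open import Data.Fin using (Fin; toℕ)
open import Data.Bool using (Bool; true; false; _∨_; _∧_)
open import Data.List using (List; _∷_; [])
open import Data.List.Relation.Unary.All using (All)
open import Data.Product using (Σ; _×_)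
open import Relation.Binary.PropositionalEquality using (_≡_)
open import Relation.Nullary using (¬_)
open import Function.Definitions using (Injective; Surjective)

record Graph : Set where
  constructor mkGraph
  field
    n   : ℕ
    adj : Fin n → Fin n → Bool
open Graph public

IsSimple : Graph → Set
IsSimple G = (∀ i j → adj G i j ≡ adj G j i) × (∀ i → adj G i i ≡ false)

data Walk (G : Graph) : Fin (n G) → Fin (n G) → Set where
  here : ∀ {u} → Walk G u u
  step : ∀ {u w v} → adj G u w ≡ true → Walk G w v → Walk G u v

Connected : Graph → Set
Connected G = ∀ u v → Walk G u v

InducedSub : Graph → Graph → Set
InducedSub H G =
  Σ (Fin (n H) → Fin (n G)) λ f →
    Injective _≡_ _≡_ f × (∀ i j → adj H i j ≡ adj G (f i) (f j))

Iso : Graph → Graph → Set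
Iso G H =
  Σ (Fin (n G) → Fin (n H)) λ f →
    Injective _≡_ _≡_ f × Surjective _≡_ _≡_ f × (∀ i j → adj G i j ≡ adj H (f i) (f j))

Free : List Graph → Graph → Set
Free S G = All (λ H → ¬ InducedSub H G) S

-- The cycle C_n on vertices 0..n-1, i ~ j iff j = i ± 1 (mod n).
-- (A simple chordless cycle for n ≥ 3.)
cycleAdj : (m : ℕ) → Fin m → Fin m → Bool
cycleAdj m i j =
  (suc a ≡ᵇ b) ∨ (suc b ≡ᵇ a) ∨ ((a ≡ᵇ 0) ∧ (suc b ≡ᵇ m)) ∨ ((b ≡ᵇ 0) ∧ (suc a ≡ᵇ m))
  where
  a = toℕ i
  b = toℕ j

C : ℕ → Graph
C m = mkGraph m (cycleAdj m)

clawAdj : ℕ → ℕ → Bool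
clawAdj 0 (suc _) = true
clawAdj (suc _) 0 = true
clawAdj _ _ = false

K13 : Graph
K13 = mkGraph 4 (λ i j → clawAdj (toℕ i) (toℕ j))

-- Hammer: x1..x5 ↦ 0..4, edges x1x2, x1x3, x2x3, x1x4, x4x5.
hammerEdge : ℕ → ℕ → Bool
hammerEdge 0 1 = true
hammerEdge 0 2 = true
hammerEdge 1 2 = true
hammerEdge 0 3 = true
hammerEdge 3 4 = true
hammerEdge _ _ = false

hammer : Graph
hammer = mkGraph 5 (λ i j → hammerEdge (toℕ i) (toℕ j) ∨ hammerEdge (toℕ j) (toℕ i))

module Submission where

-- As G is connected, it suffices that every
-- neighbour v of the image lies in the image, and as C_m is vertex-transitive we may assume v is
-- adjacent to the cycle vertex 2. If v is outside the image, claw-freeness at vertex 2 makes v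
-- adjacent to two consecutive cycle vertices; hammer-freeness then gives v further neighbours on
-- both sides along the cycle, and three of its neighbours on the cycle form an independent set,
-- i.e. a claw centred at v.

open import Defs
open import Data.Bool using (Bool; true; false; T; _∨_; _∧_)
open import Data.Bool.Properties using (T-≡; T-∨; ⇔→≡; ∨-comm; ∨-identityʳ)
open import Data.Bool.Solver using (module ∨-∧-Solver)
open import Data.Empty using (⊥; ⊥-elim)
open import Data.Fin using (Fin; zero; suc; toℕ; fromℕ; inject₁; _<_; #_)
open import Data.Fin.Induction using (>-weakInduction)
open import Data.Fin.Properties
  using (toℕ-injective; toℕ-fromℕ; toℕ-inject₁; fromℕ≢inject₁; inject₁-injective; <-cmp; any?; _≟_)
open import Data.List using (_∷_; [])
open import Data.List.Relation.Unary.All using (_∷_; [])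
open import Data.Nat using (ℕ; suc; _+_; _≤_; _≡ᵇ_; s≤s)
open import Data.Nat.Properties using (≡ᵇ⇒≡; ≡⇒≡ᵇ; m≤n⇒∃[o]m+o≡n)
open import Data.Product using (_×_; _,_; proj₁; proj₂; ∃)
open import Data.Sum using (_⊎_; inj₁; inj₂; [_,_]′)
open import Data.Sum.Function.Propositional using (_⊎-⇔_)
open import Function using (_∘_)
open import Function.Bundles using (_⇔_; mk⇔)
open import Function.Definitions using (Injective)
open import Function.Properties.Equivalence using () renaming (trans to ⇔-trans; sym to ⇔-sym)
open import Relation.Binary.Definitions using (tri<; tri≈; tri>)
open import Relation.Binary.PropositionalEquality
open import Relation.Nullary using (¬_; yes; no)
open import Relation.Nullary.Decidable using (False; toWitnessFalse)

cyclePred : ∀ {m} → Fin (suc m) → Fin (suc m)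
cyclePred zero    = fromℕ _
cyclePred (suc i) = inject₁ i

cyclePred-injective : ∀ {m} → Injective _≡_ _≡_ (cyclePred {m})
cyclePred-injective {x = zero}  {zero}  _ = refl
cyclePred-injective {x = zero}  {suc _} e = ⊥-elim (fromℕ≢inject₁ e)
cyclePred-injective {x = suc _} {zero}  e = ⊥-elim (fromℕ≢inject₁ (sym e))
cyclePred-injective {x = suc _} {suc _} e = cong suc (inject₁-injective e)

cycleSuccᵇ : ℕ → ℕ → ℕ → Bool
cycleSuccᵇ m a b = ((b ≡ᵇ 0) ∧ (suc a ≡ᵇ m)) ∨ (suc a ≡ᵇ b)

T[toℕ≡ᵇ]⇔ : ∀ {m} (i j : Fin m) {a} → toℕ j ≡ a → T (toℕ i ≡ᵇ a) ⇔ j ≡ i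
T[toℕ≡ᵇ]⇔ i j refl = mk⇔ (λ t → toℕ-injective (sym (≡ᵇ⇒≡ _ _ t))) (≡⇒≡ᵇ _ _ ∘ sym ∘ cong toℕ)

cycleSuccᵇ⇔cyclePred : ∀ {m} (i j : Fin (suc m)) →
  T (cycleSuccᵇ (suc m) (toℕ i) (toℕ j)) ⇔ cyclePred j ≡ i
cycleSuccᵇ⇔cyclePred {m} i zero rewrite ∨-identityʳ (toℕ i ≡ᵇ m) = T[toℕ≡ᵇ]⇔ i (fromℕ m) (toℕ-fromℕ m)
cycleSuccᵇ⇔cyclePred i (suc j) = T[toℕ≡ᵇ]⇔ i (inject₁ j) (toℕ-inject₁ j)

cycleAdj≡cycleSuccᵇ : ∀ m (i j : Fin m) →
  cycleAdj m i j ≡ cycleSuccᵇ m (toℕ i) (toℕ j) ∨ cycleSuccᵇ m (toℕ j) (toℕ i)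
cycleAdj≡cycleSuccᵇ m i j = solve 4 (λ p q r s → p :+ (q :+ (r :+ s)) := (s :+ p) :+ (r :+ q)) refl
  (suc (toℕ i) ≡ᵇ toℕ j) (suc (toℕ j) ≡ᵇ toℕ i)
  ((toℕ i ≡ᵇ 0) ∧ (suc (toℕ j) ≡ᵇ m)) ((toℕ j ≡ᵇ 0) ∧ (suc (toℕ i) ≡ᵇ m))
  where open ∨-∧-Solver

cycleAdj⇔cyclePred : ∀ {m} (i j : Fin (suc m)) →
  T (cycleAdj (suc m) i j) ⇔ (cyclePred j ≡ i ⊎ cyclePred i ≡ j)
cycleAdj⇔cyclePred {m} i j rewrite cycleAdj≡cycleSuccᵇ (suc m) i j =
  ⇔-trans T-∨ (cycleSuccᵇ⇔cyclePred i j ⊎-⇔ cycleSuccᵇ⇔cyclePred j i)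

cycleAdj-cyclePred : ∀ {m} (i j : Fin (suc m)) →
  cycleAdj (suc m) (cyclePred i) (cyclePred j) ≡ cycleAdj (suc m) i j
cycleAdj-cyclePred i j = ⇔→≡ (⇔-trans (⇔-sym T-≡) (⇔-trans T-rotated T-≡))
  where
  cyclePred-≡ : ∀ {x y} → (cyclePred x ≡ cyclePred y) ⇔ (x ≡ y)
  cyclePred-≡ = mk⇔ cyclePred-injective (cong cyclePred)
  T-rotated : T (cycleAdj _ (cyclePred i) (cyclePred j)) ⇔ T (cycleAdj _ i j)
  T-rotated = ⇔-trans (cycleAdj⇔cyclePred (cyclePred i) (cyclePred j))
    (⇔-trans (cyclePred-≡ ⊎-⇔ cyclePred-≡) (⇔-sym (cycleAdj⇔cyclePred i j)))

K13-simple : IsSimple K13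
K13-simple = (λ i j → clawAdj-sym (toℕ i) (toℕ j)) , λ i → clawAdj-irrefl (toℕ i)
  where
  clawAdj-sym : ∀ a b → clawAdj a b ≡ clawAdj b a
  clawAdj-sym 0       0       = refl
  clawAdj-sym 0       (suc _) = refl
  clawAdj-sym (suc _) 0       = refl
  clawAdj-sym (suc _) (suc _) = refl
  clawAdj-irrefl : ∀ a → clawAdj a a ≡ false
  clawAdj-irrefl 0       = refl
  clawAdj-irrefl (suc _) = refl

hammer-simple : IsSimple hammer
hammer-simple = (λ i j → ∨-comm (hammerEdge (toℕ i) (toℕ j)) _) , irrefl
  where
  irrefl : ∀ i → adj hammer i i ≡ false
  irrefl zero                         = refl
  irrefl (suc zero)                   = refl
  irrefl (suc (suc zero))             = refl
  irrefl (suc (suc (suc zero)))       = refl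
  irrefl (suc (suc (suc (suc zero)))) = refl

module InducedSubgraphs (G : Graph) (simple : IsSimple G) where

  V : Set
  V = Fin (n G)

  _∼_ : V → V → Set
  x ∼ y = adj G x y ≡ true

  ∼-sym : ∀ {x y} → x ∼ y → y ∼ x
  ∼-sym {x} {y} = trans (proj₁ simple y x)

  ∼⇒≢ : ∀ {x y} → x ∼ y → x ≢ y
  ∼⇒≢ {x} x∼x refl with trans (sym (proj₂ simple x)) x∼x
  ... | ()

  -- What an induced embedding requires of the images of two distinct vertices with adjacency b.
  Realises : Bool → V → V → Set
  Realises true  x y = x ∼ y
  Realises false x y = adj G x y ≡ false × x ≢ y

  Realises-sym : ∀ b {x y} → Realises b x y → Realises b y x
  Realises-sym true  x∼y         = ∼-sym x∼y
  Realises-sym false (x≁y , x≢y) = trans (proj₁ simple _ _) x≁y , x≢y ∘ sym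

  Realises⇒≢ : ∀ b {x y} → Realises b x y → x ≢ y
  Realises⇒≢ true  = ∼⇒≢
  Realises⇒≢ false = proj₂

  Realises⇒≡ : ∀ b {x y} → Realises b x y → b ≡ adj G x y
  Realises⇒≡ true  = sym
  Realises⇒≡ false = sym ∘ proj₁

  inducedSub : (H : Graph) → IsSimple H → (h : Fin (n H) → V) →
    (∀ {i j} → i < j → Realises (adj H i j) (h i) (h j)) → InducedSub H G
  inducedSub H (symH , irreflH) h upper = h , injective , preserves
    where
    injective : ∀ {i j} → h i ≡ h j → i ≡ j
    injective {i} {j} hi≡hj with <-cmp i j
    ... | tri< i<j _ _ = ⊥-elim (Realises⇒≢ (adj H i j) (upper i<j) hi≡hj)
    ... | tri≈ _ i≡j _ = i≡j
    ... | tri> _ _ j<i = ⊥-elim (Realises⇒≢ (adj H j i) (upper j<i) (sym hi≡hj))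
    preserves : ∀ i j → adj H i j ≡ adj G (h i) (h j)
    preserves i j with <-cmp i j
    ... | tri< i<j _ _ = Realises⇒≡ (adj H i j) (upper i<j)
    ... | tri≈ _ refl _ = trans (irreflH i) (sym (proj₂ simple (h i)))
    ... | tri> _ _ j<i = trans (symH i j)
      (trans (Realises⇒≡ (adj H j i) (upper j<i)) (proj₁ simple (h j) (h i)))

  realises : ∀ {H} (e : InducedSub H G) i j → i ≢ j → Realises (adj H i j) (proj₁ e i) (proj₁ e j)
  realises {H} (f , f-injective , preserves) i j i≢j with adj H i j | preserves i j
  ... | true  | eq = sym eq
  ... | false | eq = sym eq , i≢j ∘ f-injective

  inducedClaw : ∀ {c x y z} → c ∼ x → c ∼ y → c ∼ z →
    Realises false x y → Realises false x z → Realises false y z → InducedSub K13 G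
  inducedClaw {c} {x} {y} {z} c∼x c∼y c∼z xy xz yz = inducedSub K13 K13-simple vertex upper
    where
    vertex : Fin 4 → V
    vertex zero                   = c
    vertex (suc zero)             = x
    vertex (suc (suc zero))       = y
    vertex (suc (suc (suc zero))) = z
    upper : ∀ {i j} → i < j → Realises (adj K13 i j) (vertex i) (vertex j)
    upper {zero}                 {suc zero}             _ = c∼x
    upper {zero}                 {suc (suc zero)}       _ = c∼y
    upper {zero}                 {suc (suc (suc zero))} _ = c∼z
    upper {suc zero}             {suc (suc zero)}       _ = xy
    upper {suc zero}             {suc (suc (suc zero))} _ = xz
    upper {suc (suc zero)}       {suc (suc (suc zero))} _ = yz
    upper {zero}                 {zero}                 ()
    upper {suc _}                {zero}                 ()
    upper {suc zero}             {suc zero}             (s≤s ())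
    upper {suc (suc _)}          {suc zero}             (s≤s ())
    upper {suc (suc zero)}       {suc (suc zero)}       (s≤s (s≤s ()))
    upper {suc (suc (suc _))}    {suc (suc zero)}       (s≤s (s≤s ()))
    upper {suc (suc (suc zero))} {suc (suc (suc zero))} (s≤s (s≤s (s≤s ())))

  inducedHammer : ∀ {x₀ x₁ x₂ x₃ x₄} → x₀ ∼ x₁ → x₀ ∼ x₂ → x₁ ∼ x₂ → x₀ ∼ x₃ → x₃ ∼ x₄ →
    Realises false x₀ x₄ → Realises false x₁ x₃ → Realises false x₁ x₄ →
    Realises false x₂ x₃ → Realises false x₂ x₄ → InducedSub hammer G
  inducedHammer {x₀} {x₁} {x₂} {x₃} {x₄} e01 e02 e12 e03 e34 n04 n13 n14 n23 n24 =
    inducedSub hammer hammer-simple vertex upper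
    where
    vertex : Fin 5 → V
    vertex zero                         = x₀
    vertex (suc zero)                   = x₁
    vertex (suc (suc zero))             = x₂
    vertex (suc (suc (suc zero)))       = x₃
    vertex (suc (suc (suc (suc zero)))) = x₄
    upper : ∀ {i j} → i < j → Realises (adj hammer i j) (vertex i) (vertex j)
    upper {zero}                       {suc zero}                   _ = e01
    upper {zero}                       {suc (suc zero)}             _ = e02
    upper {zero}                       {suc (suc (suc zero))}       _ = e03
    upper {zero}                       {suc (suc (suc (suc zero)))} _ = n04
    upper {suc zero}                   {suc (suc zero)}             _ = e12
    upper {suc zero}                   {suc (suc (suc zero))}       _ = n13
    upper {suc zero}                   {suc (suc (suc (suc zero)))} _ = n14
    upper {suc (suc zero)}             {suc (suc (suc zero))}       _ = n23
    upper {suc (suc zero)}             {suc (suc (suc (suc zero)))} _ = n24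
    upper {suc (suc (suc zero))}       {suc (suc (suc (suc zero)))} _ = e34
    upper {zero}                       {zero}                       ()
    upper {suc _}                      {zero}                       ()
    upper {suc zero}                   {suc zero}                   (s≤s ())
    upper {suc (suc _)}                {suc zero}                   (s≤s ())
    upper {suc (suc zero)}             {suc (suc zero)}             (s≤s (s≤s ()))
    upper {suc (suc (suc _))}          {suc (suc zero)}             (s≤s (s≤s ()))
    upper {suc (suc (suc zero))}       {suc (suc (suc zero))}       (s≤s (s≤s (s≤s ())))
    upper {suc (suc (suc (suc zero)))} {suc (suc (suc zero))}       (s≤s (s≤s (s≤s ())))
    upper {suc (suc (suc (suc zero)))} {suc (suc (suc (suc zero)))} (s≤s (s≤s (s≤s (s≤s ()))))

  InImage : ∀ {H} → InducedSub H G → V → Set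
  InImage {H} e v = ∃ λ (i : Fin (n H)) → proj₁ e i ≡ v

  walk-closed : (P : V → Set) → (∀ {x y} → P x → x ∼ y → P y) → ∀ {u w} → Walk G u w → P u → P w
  walk-closed P closed here        Pu = Pu
  walk-closed P closed (step e ws) Pu = walk-closed P closed ws (closed Pu e)

  iso-of-surjective : ∀ {H} (e : InducedSub H G) → (∀ v → InImage e v) → Iso G H
  iso-of-surjective {H} (f , f-injective , preserves) onto = g , g-injective , g-surjective , g-preserves
    where
    g : V → Fin (n H)
    g v = proj₁ (onto v)
    f∘g : ∀ v → f (g v) ≡ v
    f∘g v = proj₂ (onto v)
    g-injective : Injective _≡_ _≡_ g
    g-injective {x} {y} gx≡gy = trans (sym (f∘g x)) (trans (cong f gx≡gy) (f∘g y))
    g-surjective : ∀ i → ∃ λ v → ∀ {w} → w ≡ v → g w ≡ i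
    g-surjective i = f i , λ { refl → f-injective (f∘g (f i)) }
    g-preserves : ∀ x y → adj G x y ≡ adj H (g x) (g y)
    g-preserves x y = trans (sym (cong₂ (adj G) (f∘g x) (f∘g y))) (sym (preserves (g x) (g y)))

  rotate : ∀ {m} → InducedSub (C (suc m)) G → InducedSub (C (suc m)) G
  rotate (f , f-injective , preserves) =
    f ∘ cyclePred , cyclePred-injective ∘ f-injective ,
    λ i j → trans (sym (cycleAdj-cyclePred i j)) (preserves (cyclePred i) (cyclePred j))

  InImage-rotate : ∀ {m} (e : InducedSub (C (suc m)) G) {v} → InImage (rotate e) v → InImage e v
  InImage-rotate e (j , fj≡v) = cyclePred j , fj≡v

  NeighboursInImage : ∀ {m} → InducedSub (C m) G → Fin m → Set
  NeighboursInImage e i = ∀ {v} → proj₁ e i ∼ v → InImage e v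

  -- Vertex 2 is no special case: rotating the embedding moves it backwards around the cycle.
  neighboursInImage-everywhere : ∀ {m} → (∀ e → NeighboursInImage e (# 2)) →
    ∀ (e : InducedSub (C (3 + m)) G) i → NeighboursInImage e i
  neighboursInImage-everywhere base e i =
    >-weakInduction P (back zero (back (# 1) (back (# 2) base))) (back ∘ suc) i e
    where
    P : Fin (3 + _) → Set
    P i = ∀ e → NeighboursInImage e i
    back : ∀ i → P i → P (cyclePred i)
    back i Pi e i∼v = InImage-rotate e (Pi (rotate e) i∼v)

module ClawHammerFree (G : Graph) (simple : IsSimple G)
  (claw-free : ¬ InducedSub K13 G) (hammer-free : ¬ InducedSub hammer G) where

  open InducedSubgraphs G simple

  claw-free-dichotomy : ∀ {c x y z} → c ∼ x → c ∼ y → c ∼ z → Realises false x y →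
    x ≢ z → y ≢ z → x ∼ z ⊎ y ∼ z
  claw-free-dichotomy {x = x} {y} {z} c∼x c∼y c∼z xy x≢z y≢z with adj G x z in xz | adj G y z in yz
  ... | true  | _     = inj₁ refl
  ... | false | true  = inj₂ refl
  ... | false | false = ⊥-elim (claw-free (inducedClaw c∼x c∼y c∼z xy (xz , x≢z) (yz , y≢z)))

  hammer-free-extend : ∀ {x₀ x₁ x₂ x₃ v} → x₀ ∼ x₁ → x₁ ∼ x₂ → x₂ ∼ x₃ →
    Realises false x₀ x₂ → Realises false x₀ x₃ → Realises false x₁ x₃ →
    x₀ ∼ v → x₁ ∼ v → x₂ ≢ v → x₃ ≢ v → x₂ ∼ v ⊎ x₃ ∼ v
  hammer-free-extend {x₂ = x₂} {x₃} {v} x₀∼x₁ x₁∼x₂ x₂∼x₃ n02 n03 n13 x₀∼v x₁∼v x₂≢v x₃≢v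
    with adj G x₂ v in x₂v | adj G x₃ v in x₃v
  ... | true  | _     = inj₁ refl
  ... | false | true  = inj₂ refl
  ... | false | false = ⊥-elim (hammer-free (inducedHammer x₁∼v (∼-sym x₀∼x₁) (∼-sym x₀∼v) x₁∼x₂ x₂∼x₃
    n13 (Realises-sym false (x₂v , x₂≢v)) (Realises-sym false (x₃v , x₃≢v)) n02 n03))

  module CycleEmbedding {k} (e : InducedSub (C (7 + k)) G) where

    -- For literal s, t the index 7 + k makes cycleAdj reduce, so this is an edge or a non-edge.
    onCycle : ∀ s t {s≢t : False (s ≟ t)} → Realises (cycleAdj (7 + k) s t) (proj₁ e s) (proj₁ e t)
    onCycle s t {s≢t} = realises e s t (toWitnessFalse s≢t)

    outside : ∀ {v} → ¬ InImage e v → ∀ s → proj₁ e s ≢ v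
    outside v∉e s fs≡v = v∉e (s , fs≡v)

  -- Hammer-freeness gives v further neighbours on both sides of the edge, and then three
  -- of its neighbours on the cycle are pairwise non-adjacent.
  outside-not-adjacent-to-edge : ∀ {k} (e : InducedSub (C (7 + k)) G) {v} → ¬ InImage e v →
    proj₁ e (# 2) ∼ v → proj₁ e (# 3) ∼ v → ⊥
  outside-not-adjacent-to-edge {k} e {v} v∉e 2∼v 3∼v = conclude left right
    where
    open CycleEmbedding e
    f : Fin (7 + k) → V
    f = proj₁ e
    no-claw-at-v : ∀ {a b c} → a ∼ v → b ∼ v → c ∼ v →
      Realises false a b → Realises false a c → Realises false b c → ⊥
    no-claw-at-v a∼v b∼v c∼v ab ac bc =
      claw-free (inducedClaw (∼-sym a∼v) (∼-sym b∼v) (∼-sym c∼v) ab ac bc)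
    left : f (# 1) ∼ v ⊎ f (# 0) ∼ v
    left = hammer-free-extend (onCycle (# 3) (# 2)) (onCycle (# 2) (# 1)) (onCycle (# 1) (# 0))
      (onCycle (# 3) (# 1)) (onCycle (# 3) (# 0)) (onCycle (# 2) (# 0)) 3∼v 2∼v
      (outside v∉e (# 1)) (outside v∉e (# 0))
    right : f (# 4) ∼ v ⊎ f (# 5) ∼ v
    right = hammer-free-extend (onCycle (# 2) (# 3)) (onCycle (# 3) (# 4)) (onCycle (# 4) (# 5))
      (onCycle (# 2) (# 4)) (onCycle (# 2) (# 5)) (onCycle (# 3) (# 5)) 2∼v 3∼v
      (outside v∉e (# 4)) (outside v∉e (# 5))
    further : f (# 4) ∼ v → f (# 5) ∼ v ⊎ f (# 6) ∼ v
    further 4∼v = hammer-free-extend (onCycle (# 3) (# 4)) (onCycle (# 4) (# 5)) (onCycle (# 5) (# 6))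
      (onCycle (# 3) (# 5)) (onCycle (# 3) (# 6)) (onCycle (# 4) (# 6)) 3∼v 4∼v
      (outside v∉e (# 5)) (outside v∉e (# 6))
    conclude : f (# 1) ∼ v ⊎ f (# 0) ∼ v → f (# 4) ∼ v ⊎ f (# 5) ∼ v → ⊥
    conclude (inj₂ 0∼v) (inj₁ 4∼v) =
      no-claw-at-v 0∼v 2∼v 4∼v (onCycle (# 0) (# 2)) (onCycle (# 0) (# 4)) (onCycle (# 2) (# 4))
    conclude (inj₂ 0∼v) (inj₂ 5∼v) =
      no-claw-at-v 0∼v 3∼v 5∼v (onCycle (# 0) (# 3)) (onCycle (# 0) (# 5)) (onCycle (# 3) (# 5))
    conclude (inj₁ 1∼v) (inj₂ 5∼v) =
      no-claw-at-v 1∼v 3∼v 5∼v (onCycle (# 1) (# 3)) (onCycle (# 1) (# 5)) (onCycle (# 3) (# 5))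
    conclude (inj₁ 1∼v) (inj₁ 4∼v) with further 4∼v
    ... | inj₁ 5∼v =
      no-claw-at-v 1∼v 3∼v 5∼v (onCycle (# 1) (# 3)) (onCycle (# 1) (# 5)) (onCycle (# 3) (# 5))
    ... | inj₂ 6∼v =
      no-claw-at-v 1∼v 3∼v 6∼v (onCycle (# 1) (# 3)) (onCycle (# 1) (# 6)) (onCycle (# 3) (# 6))

  neighboursInImage-2 : ∀ {k} (e : InducedSub (C (7 + k)) G) → NeighboursInImage e (# 2)
  neighboursInImage-2 e {v} 2∼v with any? (λ i → proj₁ e i ≟ v)
  ... | yes v∈e = v∈e
  ... | no  v∉e = ⊥-elim ([ via-rotation , outside-not-adjacent-to-edge e v∉e 2∼v ]′ 1∼v⊎3∼v)
    where
    open CycleEmbedding e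
    via-rotation : proj₁ e (# 1) ∼ v → ⊥
    via-rotation 1∼v = outside-not-adjacent-to-edge (rotate e) (v∉e ∘ InImage-rotate e) 1∼v 2∼v
    1∼v⊎3∼v : proj₁ e (# 1) ∼ v ⊎ proj₁ e (# 3) ∼ v
    1∼v⊎3∼v = claw-free-dichotomy (onCycle (# 2) (# 1)) (onCycle (# 2) (# 3)) 2∼v (onCycle (# 1) (# 3))
      (outside v∉e (# 1)) (outside v∉e (# 3))

lemma3 : (G : Graph) → IsSimple G → Connected G → Free (K13 ∷ hammer ∷ []) G →
    (m : ℕ) → 7 ≤ m → InducedSub (C m) G → Iso G (C m)
lemma3 G simple connected (claw-free ∷ hammer-free ∷ []) m 7≤m e with m≤n⇒∃[o]m+o≡n 7≤m
... | k , refl = iso-of-surjective e λ v →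
  walk-closed (InImage e) closed (connected (proj₁ e zero) v) (zero , refl)
  where
  open InducedSubgraphs G simple
  open ClawHammerFree G simple claw-free hammer-free
  closed : ∀ {x y} → InImage e x → x ∼ y → InImage e y
  closed (i , refl) = neighboursInImage-everywhere neighboursInImage-2 e i
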